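{- The set $\mathrm{Sort}(\mathfrak{s}_{3\underline{21}})=\bigcup_{n\ge1}\mathrm{Sort}_n(\mathfrak{s}_{3\underline{21}})$ is a permutation class, i.e. it is closed under taking (classical) patterns.
   Context: A pattern is a permutation $\sigma$ in which some blocks of consecutive entries may be underlined; a sequence contains it if it has a subsequence order-isomorphic to $\sigma$ whose entries corresponding to a common underlined block are adjacent in the sequence. Pattern-avoiding stack map $\mathfrak{s}_\sigma$: process input $\tau_1,\dots,\tau_n$ in order; when $\tau_i$ is next, while the stack is nonempty and the sequence formed by placing $\tau_i$ on top of the stack, read top to bottom, contains $\sigma$ (underlined entries adjacent in the stack), pop the top entry to the output; then push $\tau_i$; at the end pop all remaining entries top to bottom to the output. $\mathrm{Sort}_n(\mathfrak{s}_\sigma)$ is the set of $\tau\in\mathfrak S_n$ such that $\mathfrak{s}_\sigma(\tau)$ avoids $231$ (equivalently, is sorted to the identity by West's stack-sorting map). -}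

module Defs where

open import Data.Nat using (ℕ; zero; suc; _<_; _≤_; _<ᵇ_)
open import Data.Bool using (Bool; true; false; _∧_; _∨_; if_then_else_)
open import Data.List using (List; []; _∷_; _++_; map; upTo; length; lookup)
open import Data.List.Relation.Binary.Permutation.Propositional using (_↭_)
open import Data.List.Relation.Binary.Sublist.Propositional using (_⊆_)
open import Data.Fin using (Fin; cast; _<_)
open import Data.Product using (Σ; ∃; _×_; _,_; proj₁; proj₂)
open import Relation.Binary.PropositionalEquality using (_≡_)
open import Relation.Nullary using (¬_)
open import Function.Bundles using (_⇔_)

IsPerm : ℕ → List ℕ → Set
IsPerm n τ = τ ↭ map suc (upTo n)

OrderIso : List ℕ → List ℕ → Set
OrderIso xs ys =
  Σ (length xs ≡ length ys) λ eq →
    ∀ (i j : Fin (length xs)) →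
      (lookup xs i Data.Nat.< lookup xs j) ⇔ (lookup ys (cast eq i) Data.Nat.< lookup ys (cast eq j))

Contains : List ℕ → List ℕ → Set
Contains τ π = ∃ λ σ → (σ ⊆ τ) × OrderIso σ π

Avoids231 : List ℕ → Set
Avoids231 w = ¬ (Σ (Fin (length w)) λ i → Σ (Fin (length w)) λ j → Σ (Fin (length w)) λ k →
  (i Data.Fin.< j) × (j Data.Fin.< k) ×
  (lookup w k Data.Nat.< lookup w i) × (lookup w i Data.Nat.< lookup w j))

-- Containment of the pattern 3\underline{21} (the "2" and "1" adjacent):
-- some a < b < b+1 with w_a > w_b > w_{b+1}.
-- hasAdjBelow x r : r has two adjacent entries y, z with x > y > z
hasAdjBelow : ℕ → List ℕ → Bool
hasAdjBelow x (y ∷ z ∷ r) = ((y <ᵇ x) ∧ (z <ᵇ y)) ∨ hasAdjBelow x (z ∷ r)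
hasAdjBelow x _ = false

contains3-21 : List ℕ → Bool
contains3-21 [] = false
contains3-21 (x ∷ r) = hasAdjBelow x r ∨ contains3-21 r

-- With next input x and stack st (head = top): pop while the stack is
-- nonempty and x placed on top of the stack gives a sequence containing 3̲2̲1.
-- Returns (popped entries in output order, remaining stack).
popLoop : ℕ → List ℕ → List ℕ × List ℕ
popLoop x [] = [] , []
popLoop x (s ∷ st) =
  if contains3-21 (x ∷ s ∷ st)
  then (s ∷ proj₁ (popLoop x st) , proj₂ (popLoop x st))
  else ([] , s ∷ st)

run : List ℕ → List ℕ → List ℕ
run [] st = st   -- remaining entries popped top to bottom
run (x ∷ xs) st = proj₁ (popLoop x st) ++ run xs (x ∷ proj₂ (popLoop x st))

s3-21 : List ℕ → List ℕ
s3-21 τ = run τ []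

Sort : ℕ → List ℕ → Set
Sort n τ = IsPerm n τ × Avoids231 (s3-21 τ)

InSortClass : List ℕ → Set
InSortClass τ = Σ ℕ λ n → (1 ≤ n) × Sort n τ

{-# OPTIONS --safe #-}
-- Sort(𝔰_{3̲2̲1}) consists exactly of the permutations avoiding 123 and 132, a class defined by
-- pattern avoidance. Read top to bottom, the stack holds the reversed input as long as nothing has
-- been popped, so an occurrence of 123 or 132 in the input appears in the stack as three entries
-- whose lowest one is deepest. Pushing an entry x that completes such a triple x, b, a forces a 231
-- into the output. If x pops something, the last popped entry s, then x, then the new top t satisfy
-- t < s < x. If x pops nothing, then x < b gives the 231 x b a, while x > b is impossible: the entry
-- right under b is smaller than b (else it would form such a triple with b and a), an adjacent
-- descent below x that would have forced a pop. Conversely, on Av(123, 132) nothing is ever popped,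
-- so the output is the reversed input, which avoids 231 because the input avoids 132.

module Submission where

open import Defs
open import Data.Nat using (ℕ; _≤_; _<_; _<ᵇ_; s≤s; z≤n; _<?_)
open import Data.Nat.Properties using (<ᵇ⇒<; <⇒<ᵇ; ≮⇒≥; <-≤-trans; <-trans; <-cmp; suc-injective)
open import Data.Bool using (true; false; T; _∧_)
open import Data.Bool.Properties using (T-∨; T-∧)
open import Data.Empty using (⊥-elim)
open import Data.Sum using (inj₁; inj₂; [_,_]′)
open import Data.Product using (∃-syntax; _×_; _,_; proj₁; proj₂)
open import Data.List using (List; []; _∷_; _++_; reverse; reverseAcc; length; lookup)
open import Data.List.Relation.Binary.Sublist.Propositional using (_⊆_; []; _∷_; _∷ʳ_; ⊆-refl; ⊆-trans; minimum)
open import Data.List.Relation.Binary.Sublist.Propositional.Properties using (++⁺; reverseAcc⁺; reverse⁺; reverse⁻; All-resp-⊆)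
open import Data.List.Relation.Binary.Permutation.Propositional using (_↭_; ↭-sym; ↭⇒↭ₛ)
open import Data.List.Relation.Binary.Permutation.Propositional.Properties using (shift)
import Data.List.Relation.Binary.Permutation.Setoid.Properties as Permₛ
import Data.List.Relation.Unary.All as All
open import Data.List.Relation.Unary.All.Properties using (++⁻ˡ)
import Data.List.Relation.Unary.AllPairs as AllPairs
open import Data.List.Relation.Unary.Unique.Propositional using (Unique)
open import Data.List.Relation.Unary.Unique.Propositional.Properties using (map⁺; upTo⁺)
open import Data.Fin using (Fin; cast; toℕ) renaming (zero to fzero; suc to fsuc)
open import Data.Fin.Properties using (toℕ-cast; cast-involutive)
open import Function.Base using (_∘_)
open import Function.Bundles using (Equivalence)
open import Relation.Binary.PropositionalEquality using (_≡_; _≢_; refl; sym; trans; cong; subst; subst₂; setoid)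
open import Relation.Binary.Definitions using (tri<; tri≈; tri>)
open import Relation.Nullary using (¬_; Dec; yes; no; contraposition)
open import Relation.Nullary.Decidable using (T?)

open Equivalence using (to; from)

Pattern₃ : Set₁
Pattern₃ = ℕ → ℕ → ℕ → Set

Has : Pattern₃ → List ℕ → Set
Has R w = ∃[ a ] ∃[ b ] ∃[ c ] (a ∷ b ∷ c ∷ []) ⊆ w × R a b c

Reversed : Pattern₃ → Pattern₃
Reversed R a b c = R c b a

-- occurrences of 123 and of 132
StartsWithMin : Pattern₃
StartsWithMin a b c = a < b × a < c

EndsWithMin : Pattern₃
EndsWithMin = Reversed StartsWithMin

Is231 : Pattern₃
Is231 a b c = c < a × a < b

Has-mono : ∀ {R xs ys} → xs ⊆ ys → Has R xs → Has R ys
Has-mono xs⊆ys (a , b , c , abc⊆xs , r) = a , b , c , ⊆-trans abc⊆xs xs⊆ys , r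

Has-map : ∀ {R R′ w} → (∀ {a b c} → R a b c → R′ a b c) → Has R w → Has R′ w
Has-map f (a , b , c , abc⊆w , r) = a , b , c , abc⊆w , f r

Has-reverse⁺ : ∀ {R w} → Has R w → Has (Reversed R) (reverse w)
Has-reverse⁺ (a , b , c , abc⊆w , r) = c , b , a , reverse⁺ abc⊆w , r

Has-reverse⁻ : ∀ {R} w → Has R (reverse w) → Has (Reversed R) w
Has-reverse⁻ w (a , b , c , abc⊆w , r) = c , b , a , reverse⁻ {as = c ∷ b ∷ a ∷ []} {bs = w} abc⊆w , r

HasAt : Pattern₃ → List ℕ → Set
HasAt R w = ∃[ i ] ∃[ j ] ∃[ k ]
  toℕ i < toℕ j × toℕ j < toℕ k × R (lookup w i) (lookup w j) (lookup w k)

⊆⇒lookup₁ : ∀ {P : ℕ → Set} {a w} → (a ∷ []) ⊆ w → P a → ∃[ i ] P (lookup w i)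
⊆⇒lookup₁ (_ ∷ʳ a⊆w) p with ⊆⇒lookup₁ a⊆w p
... | i , q = fsuc i , q
⊆⇒lookup₁ (refl ∷ _) p = fzero , p

⊆⇒lookup₂ : ∀ {R : ℕ → ℕ → Set} {a b w} → (a ∷ b ∷ []) ⊆ w → R a b →
  ∃[ i ] ∃[ j ] toℕ i < toℕ j × R (lookup w i) (lookup w j)
⊆⇒lookup₂ (_ ∷ʳ ab⊆w) r with ⊆⇒lookup₂ ab⊆w r
... | i , j , i<j , q = fsuc i , fsuc j , s≤s i<j , q
⊆⇒lookup₂ {R} (refl ∷ b⊆w) r with ⊆⇒lookup₁ {R _} b⊆w r
... | j , q = fzero , fsuc j , s≤s z≤n , q

Has⇒HasAt : ∀ {R} w → Has R w → HasAt R w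
Has⇒HasAt (x ∷ w) (a , b , c , x ∷ʳ abc⊆w , r) with Has⇒HasAt w (a , b , c , abc⊆w , r)
... | i , j , k , i<j , j<k , q = fsuc i , fsuc j , fsuc k , s≤s i<j , s≤s j<k , q
Has⇒HasAt {R} (x ∷ w) (a , b , c , refl ∷ bc⊆w , r) with ⊆⇒lookup₂ {R a} bc⊆w r
... | j , k , j<k , q = fzero , fsuc j , fsuc k , s≤s z≤n , s≤s j<k , q

lookup₁⊆ : ∀ (w : List ℕ) (i : Fin (length w)) → (lookup w i ∷ []) ⊆ w
lookup₁⊆ (x ∷ w) fzero = refl ∷ minimum w
lookup₁⊆ (x ∷ w) (fsuc i) = x ∷ʳ lookup₁⊆ w i

lookup₂⊆ : ∀ (w : List ℕ) (i j : Fin (length w)) → toℕ i < toℕ j → (lookup w i ∷ lookup w j ∷ []) ⊆ w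
lookup₂⊆ (x ∷ w) fzero (fsuc j) _ = refl ∷ lookup₁⊆ w j
lookup₂⊆ (x ∷ w) (fsuc i) (fsuc j) (s≤s i<j) = x ∷ʳ lookup₂⊆ w i j i<j

lookup₃⊆ : ∀ (w : List ℕ) (i j k : Fin (length w)) → toℕ i < toℕ j → toℕ j < toℕ k →
  (lookup w i ∷ lookup w j ∷ lookup w k ∷ []) ⊆ w
lookup₃⊆ (x ∷ w) fzero (fsuc j) (fsuc k) _ (s≤s j<k) = refl ∷ lookup₂⊆ w j k j<k
lookup₃⊆ (x ∷ w) (fsuc i) (fsuc j) (fsuc k) (s≤s i<j) (s≤s j<k) = x ∷ʳ lookup₃⊆ w i j k i<j j<k

HasAt⇒Has : ∀ {R} w → HasAt R w → Has R w
HasAt⇒Has w (i , j , k , i<j , j<k , r) = _ , _ , _ , lookup₃⊆ w i j k i<j j<k , r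

Avoids231⇒¬Has231 : ∀ w → Avoids231 w → ¬ Has Is231 w
Avoids231⇒¬Has231 w avoids = avoids ∘ Has⇒HasAt w

¬Has231⇒Avoids231 : ∀ w → ¬ Has Is231 w → Avoids231 w
¬Has231⇒Avoids231 w ¬231 = ¬231 ∘ HasAt⇒Has w

module _ {σ π : List ℕ} (σ≅π : OrderIso σ π) where

  private
    eq : length σ ≡ length π
    eq = proj₁ σ≅π

    pull : Fin (length π) → Fin (length σ)
    pull = cast (sym eq)

    pull-mono : ∀ {i j} → toℕ i < toℕ j → toℕ (pull i) < toℕ (pull j)
    pull-mono {i} {j} = subst₂ _<_ (sym (toℕ-cast (sym eq) i)) (sym (toℕ-cast (sym eq) j))

    pull-reflects-< : ∀ {i j} → lookup π i < lookup π j → lookup σ (pull i) < lookup σ (pull j)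
    pull-reflects-< {i} {j} = from (proj₂ σ≅π (pull i) (pull j))
      ∘ subst₂ (λ i′ j′ → lookup π i′ < lookup π j′)
          (sym (cast-involutive eq (sym eq) i)) (sym (cast-involutive eq (sym eq) j))

  HasAt-StartsWithMin-OrderIso : HasAt StartsWithMin π → HasAt StartsWithMin σ
  HasAt-StartsWithMin-OrderIso (i , j , k , i<j , j<k , πi<πj , πi<πk) =
    pull i , pull j , pull k , pull-mono i<j , pull-mono j<k ,
    pull-reflects-< πi<πj , pull-reflects-< πi<πk

Has-StartsWithMin-Contains : ∀ {τ} π → Contains τ π → Has StartsWithMin π → Has StartsWithMin τ
Has-StartsWithMin-Contains π (σ , σ⊆τ , σ≅π) =
  Has-mono σ⊆τ ∘ HasAt⇒Has σ ∘ HasAt-StartsWithMin-OrderIso {σ} {π} σ≅π ∘ Has⇒HasAt π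

popped kept : ℕ → List ℕ → List ℕ
popped x S = proj₁ (popLoop x S)
kept x S = proj₂ (popLoop x S)

popLoop-++ : ∀ x S → popped x S ++ kept x S ≡ S
popLoop-++ x [] = refl
popLoop-++ x (s ∷ st) with contains3-21 (x ∷ s ∷ st)
... | true = cong (s ∷_) (popLoop-++ x st)
... | false = refl

popLoop-pop : ∀ {x s} st → T (contains3-21 (x ∷ s ∷ st)) → popLoop x (s ∷ st) ≡ (s ∷ popped x st , kept x st)
popLoop-pop {x} {s} st pops with contains3-21 (x ∷ s ∷ st)
... | true = refl
... | false = ⊥-elim pops

popLoop-stop : ∀ {x} S → ¬ T (contains3-21 (x ∷ S)) → popLoop x S ≡ ([] , S)
popLoop-stop [] _ = refl
popLoop-stop {x} (s ∷ st) stays with contains3-21 (x ∷ s ∷ st)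
... | true = ⊥-elim (stays _)
... | false = refl

run-∷-stop : ∀ {x} xs S → ¬ T (contains3-21 (x ∷ S)) → run (x ∷ xs) S ≡ run xs (x ∷ S)
run-∷-stop {x} xs S stays = cong (λ (P , R) → P ++ run xs (x ∷ R)) (popLoop-stop S stays)

stack⊆run : ∀ xs S → S ⊆ run xs S
stack⊆run [] S = ⊆-refl
stack⊆run (x ∷ xs) S = subst (_⊆ run (x ∷ xs) S) (popLoop-++ x S)
  (++⁺ ⊆-refl (⊆-trans (x ∷ʳ ⊆-refl) (stack⊆run xs (x ∷ kept x S))))

DescentBelow : ℕ → List ℕ → Set
DescentBelow x r = ∃[ y ] ∃[ z ] (y ∷ z ∷ []) ⊆ r × y < x × z < y

DescentBelow-∷ʳ : ∀ {x r} y → DescentBelow x r → DescentBelow x (y ∷ r)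
DescentBelow-∷ʳ y (y′ , z′ , yz⊆r , y<x , z<y) = y′ , z′ , y ∷ʳ yz⊆r , y<x , z<y

hasAdjBelow-sound : ∀ x r → T (hasAdjBelow x r) → DescentBelow x r
hasAdjBelow-sound x (y ∷ z ∷ r) h = [ at-top , DescentBelow-∷ʳ y ∘ hasAdjBelow-sound x (z ∷ r) ]′ (to T-∨ h)
  where
  at-top : T ((y <ᵇ x) ∧ (z <ᵇ y)) → DescentBelow x (y ∷ z ∷ r)
  at-top yz = y , z , refl ∷ refl ∷ minimum r , <ᵇ⇒< y x (proj₁ (to T-∧ yz)) , <ᵇ⇒< z y (proj₂ (to T-∧ yz))

contains3-21⇒EndsWithMin : ∀ w → T (contains3-21 w) → Has EndsWithMin w
contains3-21⇒EndsWithMin (x ∷ r) h with to T-∨ h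
... | inj₂ later = Has-mono (x ∷ʳ ⊆-refl) (contains3-21⇒EndsWithMin r later)
... | inj₁ adj with hasAdjBelow-sound x r adj
...   | y , z , yz⊆r , y<x , z<y = x , y , z , refl ∷ yz⊆r , z<y , <-trans z<y y<x

EndsWithMin-free⇒¬contains3-21 : ∀ {w} → ¬ Has EndsWithMin w → ¬ T (contains3-21 w)
EndsWithMin-free⇒¬contains3-21 {w} = contraposition (contains3-21⇒EndsWithMin w)

contains3-21-∷ : ∀ x r → T (contains3-21 (x ∷ r)) → ¬ T (contains3-21 r) → T (hasAdjBelow x r)
contains3-21-∷ x r h ¬r with to T-∨ h
... | inj₁ adj = adj
... | inj₂ later = ⊥-elim (¬r later)

hasAdjBelow-∷ : ∀ x s S → T (hasAdjBelow x S) → T (hasAdjBelow x (s ∷ S))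
hasAdjBelow-∷ x s (t ∷ S) h = from T-∨ (inj₂ h)

hasAdjBelow-complete : ∀ {x b a S} → (b ∷ a ∷ []) ⊆ S → a < b → b < x →
  ¬ Has EndsWithMin S → T (hasAdjBelow x S)
hasAdjBelow-complete {x} {S = s ∷ S} (s ∷ʳ ba⊆S) a<b b<x free =
  hasAdjBelow-∷ x s S (hasAdjBelow-complete ba⊆S a<b b<x (free ∘ Has-mono (s ∷ʳ ⊆-refl)))
hasAdjBelow-complete (refl ∷ refl ∷ _) a<b b<x _ = from T-∨ (inj₁ (from T-∧ (<⇒<ᵇ b<x , <⇒<ᵇ a<b)))
hasAdjBelow-complete {b = b} (refl ∷ (t ∷ʳ a⊆S)) a<b b<x free with t <? b
... | yes t<b = from T-∨ (inj₁ (from T-∧ (<⇒<ᵇ b<x , <⇒<ᵇ t<b)))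
... | no t≮b = ⊥-elim (free (b , t , _ , refl ∷ refl ∷ a⊆S , <-≤-trans a<b (≮⇒≥ t≮b) , a<b))

last-pop-231 : ∀ {x s} st → ¬ T (contains3-21 (s ∷ st)) → T (contains3-21 (x ∷ s ∷ st)) →
  ¬ T (contains3-21 (x ∷ st)) → Has Is231 (s ∷ x ∷ st)
last-pop-231 [] _ () _
last-pop-231 {x} {s} (t ∷ st) free pops stays with to T-∨ (contains3-21-∷ x (s ∷ t ∷ st) pops free)
... | inj₁ st<x = s , x , t , refl ∷ refl ∷ refl ∷ minimum st ,
                  <ᵇ⇒< t s (proj₂ (to T-∧ st<x)) , <ᵇ⇒< s x (proj₁ (to T-∧ st<x))
... | inj₂ later = ⊥-elim (stays (from T-∨ (inj₁ later)))

popLoop-creates-231 : ∀ {x} S → ¬ T (contains3-21 S) → T (contains3-21 (x ∷ S)) →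
  Has Is231 (popped x S ++ x ∷ kept x S)
popLoop-creates-231 {x} (s ∷ st) free pops =
  subst (λ (P , R) → Has Is231 (P ++ x ∷ R)) (sym (popLoop-pop st pops)) (after-pop (T? (contains3-21 (x ∷ st))))
  where
  after-pop : Dec (T (contains3-21 (x ∷ st))) → Has Is231 (s ∷ popped x st ++ x ∷ kept x st)
  after-pop (yes pops′) =
    Has-mono (s ∷ʳ ⊆-refl) (popLoop-creates-231 st (free ∘ from (T-∨ {hasAdjBelow s st}) ∘ inj₂) pops′)
  after-pop (no stays) =
    subst (λ (P , R) → Has Is231 (s ∷ P ++ x ∷ R)) (sym (popLoop-stop st stays)) (last-pop-231 st free pops stays)

push-keeps-EndsWithMin-free : ∀ {x} xs S → All.All (x ≢_) S → ¬ Has EndsWithMin S →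
  ¬ Has Is231 (run (x ∷ xs) S) → ¬ Has EndsWithMin (x ∷ S)
push-keeps-EndsWithMin-free xs S _ free _ (c , b , a , _ ∷ʳ cba⊆S , r) = free (c , b , a , cba⊆S , r)
push-keeps-EndsWithMin-free {x} xs S x∉S free no231 (x , b , a , refl ∷ ba⊆S , a<b , a<x)
  with T? (contains3-21 (x ∷ S))
... | yes pops = no231 (Has-mono (++⁺ ⊆-refl (stack⊆run xs (x ∷ kept x S)))
                         (popLoop-creates-231 S (EndsWithMin-free⇒¬contains3-21 free) pops))
... | no stays with <-cmp x b
...   | tri< x<b _ _ = no231 (subst (Has Is231) (sym (run-∷-stop xs S stays))
                         (Has-mono (stack⊆run xs (x ∷ S)) (x , b , a , refl ∷ ba⊆S , a<x , x<b)))
...   | tri≈ _ x≡b _ = All.head (All-resp-⊆ ba⊆S x∉S) x≡b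
...   | tri> _ _ b<x = stays (from T-∨ (inj₁ (hasAdjBelow-complete ba⊆S a<b b<x free)))

Unique-resp-↭ : ∀ {xs ys : List ℕ} → xs ↭ ys → Unique xs → Unique ys
Unique-resp-↭ = Permₛ.Unique-resp-↭ (setoid ℕ) ∘ ↭⇒↭ₛ

run-avoids-231⇒EndsWithMin-free : ∀ xs S → Unique (S ++ xs) → ¬ Has EndsWithMin S →
  ¬ Has Is231 (run xs S) → ¬ Has EndsWithMin (reverseAcc S xs)
run-avoids-231⇒EndsWithMin-free [] S _ free _ = free
run-avoids-231⇒EndsWithMin-free (x ∷ xs) S u free no231 =
  run-avoids-231⇒EndsWithMin-free xs (x ∷ S) u′ free′
    (no231 ∘ subst (Has Is231) (sym (run-∷-stop xs S (EndsWithMin-free⇒¬contains3-21 free′))))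
  where
  u′ : Unique (x ∷ S ++ xs)
  u′ = Unique-resp-↭ (shift x S xs) u
  free′ : ¬ Has EndsWithMin (x ∷ S)
  free′ = push-keeps-EndsWithMin-free xs S (++⁻ˡ S (AllPairs.head u′)) free no231

run-without-pops : ∀ xs S → ¬ Has EndsWithMin (reverseAcc S xs) → run xs S ≡ reverseAcc S xs
run-without-pops [] S _ = refl
run-without-pops (x ∷ xs) S free = trans (run-∷-stop xs S stays) (run-without-pops xs (x ∷ S) free)
  where
  stays : ¬ T (contains3-21 (x ∷ S))
  stays = EndsWithMin-free⇒¬contains3-21 (free ∘ Has-mono (reverseAcc⁺ (minimum xs) ⊆-refl))

sorted⇒StartsWithMin-free : ∀ τ → Unique τ → Avoids231 (s3-21 τ) → ¬ Has StartsWithMin τ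
sorted⇒StartsWithMin-free τ u sorted =
  run-avoids-231⇒EndsWithMin-free τ [] u (λ { (_ , _ , _ , () , _) }) (Avoids231⇒¬Has231 (s3-21 τ) sorted)
  ∘ Has-reverse⁺

StartsWithMin-free⇒sorted : ∀ π → ¬ Has StartsWithMin π → Avoids231 (s3-21 π)
StartsWithMin-free⇒sorted π free = ¬Has231⇒Avoids231 (s3-21 π)
  (free ∘ Has-map 132⇒StartsWithMin ∘ Has-reverse⁻ π ∘ subst (Has Is231) (run-without-pops π [] (free ∘ Has-reverse⁻ π)))
  where
  132⇒StartsWithMin : ∀ {a b c} → Reversed Is231 a b c → StartsWithMin a b c
  132⇒StartsWithMin (a<c , c<b) = <-trans a<c c<b , a<c

IsPerm⇒Unique : ∀ {n τ} → IsPerm n τ → Unique τ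
IsPerm⇒Unique {n} τ↭1…n = Unique-resp-↭ (↭-sym τ↭1…n) (map⁺ suc-injective (upTo⁺ n))

mainTheorem10 : ∀ (τ π : List ℕ) (m : ℕ) → InSortClass τ → 1 ≤ m → IsPerm m π → Contains τ π → InSortClass π
mainTheorem10 τ π m (_ , _ , τ-perm , τ-sorted) 1≤m π-perm τ⊇π =
  m , 1≤m , π-perm ,
  StartsWithMin-free⇒sorted π
    (sorted⇒StartsWithMin-free τ (IsPerm⇒Unique τ-perm) τ-sorted ∘ Has-StartsWithMin-Contains π τ⊇π)
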